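{- Let $X_0\xrightarrow{f_1}X_1\xrightarrow{f_2}X_2\xrightarrow{f_3}\cdots\xrightarrow{f_n}X_n$ be a sequence of surjective continuous maps of topological spaces such that, for each $i=0,\dots,n-1$, $X_i$ has the local product structure property with respect to $f_{i+1}$ at every point of a dense subset $Z_i\subseteq X_i$. Let $B\subseteq X_n$ be dense. Then for every $0\le i\le n-1$, every fibre-wise dense subset of the preimage of $B$ in $X_i$ is dense in $X_i$.
   Context: Local product structure: let $f:X\to Y$ be a surjective continuous map of topological spaces, $x_0\in X$, $y_0=f(x_0)$. $X$ has the local product structure property at $x_0$ with respect to $f$ if there exist a topological space $F_{x_0}$, open sets $O\subseteq X$, $U\subseteq F_{x_0}$, $V\subseteq Y$ with $x_0\in O$, $y_0\in V$, and a homeomorphism $\psi:O\to U\times V$ such that $f|_O=\pi_2\circ\psi$ where $\pi_2:U\times V\to V$ is the projection. For $g_i=f_n\circ\cdots\circ f_{i+1}:X_i\to X_n$, the preimage of $B$ in $X_i$ is $g_i^{ -1}(B)$; a subset $S\subseteq g_i^{ -1}(B)$ is fibre-wise dense if for each $b\in B$, $S\cap g_i^{ -1}(b)$ is dense in the fibre $g_i^{ -1}(b)$. -}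

module Defs where

open import Data.Nat using (ℕ; zero; suc; _≤′_; _<′_; ≤′-refl; ≤′-step)
open import Data.Product using (Σ; _×_; _,_; proj₁; proj₂)
open import Data.Unit using (⊤; tt)
open import Relation.Binary.PropositionalEquality using (_≡_)

record Top : Set₂ where
  field
    Carrier  : Set
    Open     : (Carrier → Set) → Set₁
    Open-ext : ∀ {A B : Carrier → Set} →
               (∀ x → A x → B x) → (∀ x → B x → A x) → Open A → Open B
    Open-univ : Open (λ _ → ⊤)
    Open-∩   : ∀ {A B : Carrier → Set} → Open A → Open B → Open (λ x → A x × B x)
    Open-⋃   : (I : Set) (A : I → Carrier → Set) →
               (∀ i → Open (A i)) → Open (λ x → Σ I λ i → A i x)

open Top public

Continuous : (T S : Top) → (Carrier T → Carrier S) → Set₁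
Continuous T S f = ∀ (W : Carrier S → Set) → Open S W → Open T (λ x → W (f x))

Surjective : {A B : Set} → (A → B) → Set
Surjective {A} {B} f = ∀ (b : B) → Σ A λ a → f a ≡ b

ProdOpen : (T S : Top) → (Carrier T × Carrier S → Set) → Set₁
ProdOpen T S W = ∀ p → W p →
  Σ (Carrier T → Set) λ A → Σ (Carrier S → Set) λ B →
    Open T A × Open S B × A (proj₁ p) × B (proj₂ p) ×
    (∀ q → A (proj₁ q) → B (proj₂ q) → W q)

_⊗_ : Top → Top → Top
T ⊗ S = record
  { Carrier = Carrier T × Carrier S
  ; Open = ProdOpen T S
  ; Open-ext = λ {A} {B} ab ba oA p bp →
      let (U , V , oU , oV , u , v , sub) = oA p (ba p bp)
      in U , V , oU , oV , u , v , (λ q uq vq → ab q (sub q uq vq))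
  ; Open-univ = λ p _ → (λ _ → ⊤) , (λ _ → ⊤) , Open-univ T , Open-univ S , tt , tt , (λ _ _ _ → tt)
  ; Open-∩ = λ {A} {B} oA oB p ab →
      let (U , V , oU , oV , u , v , sub) = oA p (proj₁ ab)
          (U' , V' , oU' , oV' , u' , v' , sub') = oB p (proj₂ ab)
      in (λ x → U x × U' x) , (λ y → V y × V' y) , Open-∩ T oU oU' , Open-∩ S oV oV'
         , (u , u') , (v , v') , (λ q uq vq → sub q (proj₁ uq) (proj₁ vq) , sub' q (proj₂ uq) (proj₂ vq))
  ; Open-⋃ = λ I A oA p ip →
      let (i , a) = ip
          (U , V , oU , oV , u , v , sub) = oA i p a
      in U , V , oU , oV , u , v , (λ q uq vq → i , sub q uq vq)
  }

-- Continuity of a map defined on a subset A of T (with the subspace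
-- topology on A), written out: preimages of opens are traces of opens of T.
RelContinuous : (T S : Top) (A : Carrier T → Set) → ((x : Carrier T) → A x → Carrier S) → Set₁
RelContinuous T S A h = ∀ (W : Carrier S → Set) → Open S W →
  Σ (Carrier T → Set) λ O' → Open T O' ×
    (∀ x (a : A x) → (W (h x a) → O' x) × (O' x → W (h x a)))

-- Local product structure property of X at x₀ with respect to f : X → Y.
-- ψ : O → U × V is a homeomorphism of subspaces (O ⊆ X, U × V ⊆ F × Y),
-- with inverse φ, and f|_O = π₂ ∘ ψ.
record LocalProduct (X Y : Top) (f : Carrier X → Carrier Y) (x₀ : Carrier X) : Set₂ where
  field
    F   : Top
    O   : Carrier X → Set
    U   : Carrier F → Set
    V   : Carrier Y → Set
    O-open : Open X O
    U-open : Open F U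
    V-open : Open Y V
    x₀∈O : O x₀
    y₀∈V : V (f x₀)
    ψ   : (x : Carrier X) → O x → Carrier F × Carrier Y
    ψ-into : ∀ x (o : O x) → U (proj₁ (ψ x o)) × V (proj₂ (ψ x o))
    φ   : (p : Carrier F × Carrier Y) → U (proj₁ p) × V (proj₂ p) → Carrier X
    φ-into : ∀ p (uv : U (proj₁ p) × V (proj₂ p)) → O (φ p uv)
    φψ  : ∀ x (o : O x) → φ (ψ x o) (ψ-into x o) ≡ x
    ψφ  : ∀ p (uv : U (proj₁ p) × V (proj₂ p)) → ψ (φ p uv) (φ-into p uv) ≡ p
    ψ-cont : RelContinuous X (F ⊗ Y) O ψ
    φ-cont : RelContinuous (F ⊗ Y) X (λ p → U (proj₁ p) × V (proj₂ p)) φ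
    compat : ∀ x (o : O x) → proj₂ (ψ x o) ≡ f x

Dense : (T : Top) → (Carrier T → Set) → Set₁
Dense T S = ∀ (W : Carrier T → Set) → Open T W →
  Σ (Carrier T) W → Σ (Carrier T) λ x → W x × S x

-- The composite g_i = f_n ∘ ⋯ ∘ f_{i+1} : X_i → X_n, for i < n.
-- Convention: f i : X i → X (suc i) is the paper's f_{i+1}.
compose : (X : ℕ → Top) (f : (i : ℕ) → Carrier (X i) → Carrier (X (suc i)))
          {i m : ℕ} → i <′ m → Carrier (X i) → Carrier (X m)
compose X f {i} ≤′-refl x = f i x
compose X f {i} (≤′-step {m} p) x = f m (compose X f p x)

-- S ⊆ g⁻¹(B) is fibre-wise dense: for each b ∈ B, S ∩ g⁻¹(b) is dense in
-- the fibre g⁻¹(b) with its subspace topology (opens of the fibre are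
-- traces W ∩ g⁻¹(b) of opens W of T).
FibrewiseDense : (T S : Top) (g : Carrier T → Carrier S)
                 (B : Carrier S → Set) (Sub : Carrier T → Set) → Set₁
FibrewiseDense T S g B Sub =
  (∀ x → Sub x → B (g x)) ×
  (∀ b → B b → ∀ (W : Carrier T → Set) → Open T W →
     Σ (Carrier T) (λ x → W x × g x ≡ b) →
     Σ (Carrier T) (λ x → W x × g x ≡ b × Sub x))

{-# OPTIONS --safe #-}
-- In a local product chart f is the projection π₂, so every open set around
-- a chart point has an image containing an open set around its image point.
-- With chart points dense, each fᵢ is quasi-open (the image of a nonempty
-- open set has nonempty interior), and quasi-openness survives composition.
-- So a nonempty open W ⊆ Xᵢ has an image containing a nonempty open C ⊆ Xₙ;
-- C meets the dense set B at some b, hence W meets the fibre over b, in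
-- which S is dense.
module Submission where

open import Defs
open import Level using (0ℓ)
open import Data.Nat using (ℕ; suc; _<′_; ≤′-refl; ≤′-step)
open import Data.Product using (Σ; _×_; _,_; proj₁; proj₂)
open import Relation.Unary using (Pred; _⊆_; _∩_; Satisfiable)
open import Relation.Binary.PropositionalEquality using (_≡_; sym; trans; cong; subst)

Image : {A B : Set} → (A → B) → Pred A 0ℓ → Pred B 0ℓ
Image {A} f W y = Σ A λ x → W x × f x ≡ y

QuasiOpen : (X Y : Top) → (Carrier X → Carrier Y) → Set₁
QuasiOpen X Y f = ∀ W → Open X W → Satisfiable W →
  Σ (Pred (Carrier Y) 0ℓ) λ C → Open Y C × Satisfiable C × C ⊆ Image f W

localProduct⇒openAt : (X Y : Top) (f : Carrier X → Carrier Y) {x₀ : Carrier X} →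
  LocalProduct X Y f x₀ → ∀ W → Open X W → W x₀ →
  Σ (Pred (Carrier Y) 0ℓ) λ C → Open Y C × C (f x₀) × C ⊆ Image f W
localProduct⇒openAt X Y f {x₀} lp W oW Wx₀ =
  C ∩ V , Open-∩ Y oC V-open , (Cfx₀ , subst V (compat x₀ x₀∈O) (proj₂ uv₀)) , slice⊆fW
  where
  open LocalProduct lp
  p₀ = ψ x₀ x₀∈O
  uv₀ = ψ-into x₀ x₀∈O
  φ⁻¹W = φ-cont W oW
  O' = proj₁ φ⁻¹W
  O'⇔W = proj₂ (proj₂ φ⁻¹W)
  p₀∈O' : O' p₀
  p₀∈O' = proj₁ (O'⇔W p₀ uv₀) (subst W (sym (φψ x₀ x₀∈O)) Wx₀)
  rectangle = proj₁ (proj₂ φ⁻¹W) p₀ p₀∈O'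
  A = proj₁ rectangle
  C = proj₁ (proj₂ rectangle)
  rectangle-facts = proj₂ (proj₂ rectangle)
  oC : Open Y C
  oC = proj₁ (proj₂ rectangle-facts)
  Ap₀ : A (proj₁ p₀)
  Ap₀ = proj₁ (proj₂ (proj₂ rectangle-facts))
  Cfx₀ : C (f x₀)
  Cfx₀ = subst C (compat x₀ x₀∈O) (proj₁ (proj₂ (proj₂ (proj₂ rectangle-facts))))
  A×C⊆O' = proj₂ (proj₂ (proj₂ (proj₂ rectangle-facts)))
  slice⊆fW : C ∩ V ⊆ Image f W
  slice⊆fW {y} (Cy , Vy) = φ p uv , proj₂ (O'⇔W p uv) (A×C⊆O' p Ap₀ Cy) , fφp≡y
    where
    p = proj₁ p₀ , y
    uv = proj₁ uv₀ , Vy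
    fφp≡y : f (φ p uv) ≡ y
    fφp≡y = trans (sym (compat (φ p uv) (φ-into p uv))) (cong proj₂ (ψφ p uv))

denseLocalProduct⇒quasiOpen : (X Y : Top) (f : Carrier X → Carrier Y) (Z : Pred (Carrier X) 0ℓ) →
  Dense X Z → (∀ x → Z x → LocalProduct X Y f x) → QuasiOpen X Y f
denseLocalProduct⇒quasiOpen X Y f Z dZ lp W oW W≢∅ with dZ W oW W≢∅
... | z , Wz , Zz with localProduct⇒openAt X Y f (lp z Zz) W oW Wz
...   | C , oC , Cfz , C⊆fW = C , oC , (f z , Cfz) , C⊆fW

quasiOpen-∘ : (X Y Z : Top) (f : Carrier X → Carrier Y) (g : Carrier Y → Carrier Z) →
  QuasiOpen X Y f → QuasiOpen Y Z g → QuasiOpen X Z (λ x → g (f x))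
quasiOpen-∘ X Y Z f g qf qg W oW W≢∅ with qf W oW W≢∅
... | C , oC , C≢∅ , C⊆fW with qg C oC C≢∅
...   | D , oD , D≢∅ , D⊆gC = D , oD , D≢∅ , D⊆gfW
  where
  D⊆gfW : D ⊆ Image (λ x → g (f x)) W
  D⊆gfW Dz with D⊆gC Dz
  ... | y , Cy , gy≡z with C⊆fW Cy
  ...   | x , Wx , fx≡y = x , Wx , trans (cong g fx≡y) gy≡z

compose-quasiOpen : (X : ℕ → Top) (f : (i : ℕ) → Carrier (X i) → Carrier (X (suc i))) {m : ℕ} →
  (∀ j → j <′ m → QuasiOpen (X j) (X (suc j)) (f j)) →
  ∀ {i} (lt : i <′ m) → QuasiOpen (X i) (X m) (compose X f lt)
compose-quasiOpen X f qf ≤′-refl = qf _ ≤′-refl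
compose-quasiOpen X f qf {i} (≤′-step {m} lt) =
  quasiOpen-∘ (X i) (X m) (X (suc m)) (compose X f lt) (f m)
    (compose-quasiOpen X f (λ j j<m → qf j (≤′-step j<m)) lt) (qf m ≤′-refl)

quasiOpen-fibrewiseDense⇒dense : (T S : Top) (g : Carrier T → Carrier S) →
  QuasiOpen T S g → (B : Pred (Carrier S) 0ℓ) → Dense S B →
  (Sub : Pred (Carrier T) 0ℓ) → FibrewiseDense T S g B Sub → Dense T Sub
quasiOpen-fibrewiseDense⇒dense T S g qg B dB Sub (_ , fibreDense) W oW W≢∅ with qg W oW W≢∅
... | C , oC , C≢∅ , C⊆gW with dB C oC C≢∅
...   | b , Cb , Bb with fibreDense b Bb W oW (C⊆gW Cb)
...     | x , Wx , _ , Subx = x , Wx , Subx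

mainTheorem3 : (n : ℕ) (X : ℕ → Top) (f : (i : ℕ) → Carrier (X i) → Carrier (X (suc i))) →
    (∀ i → i <′ n → Continuous (X i) (X (suc i)) (f i)) →
    (∀ i → i <′ n → Surjective (f i)) →
    (Z : (i : ℕ) → Carrier (X i) → Set) →
    (∀ i → i <′ n → Dense (X i) (Z i)) →
    (∀ i → i <′ n → ∀ x → Z i x → LocalProduct (X i) (X (suc i)) (f i) x) →
    (B : Carrier (X n) → Set) → Dense (X n) B →
    ∀ i → (lt : i <′ n) → (S : Carrier (X i) → Set) →
    FibrewiseDense (X i) (X n) (compose X f lt) B S →
    Dense (X i) S
mainTheorem3 n X f _ _ Z dZ lp B dB i lt S =
  quasiOpen-fibrewiseDense⇒dense (X i) (X n) (compose X f lt) (compose-quasiOpen X f fⱼ-quasiOpen lt) B dB S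
  where
  fⱼ-quasiOpen : ∀ j → j <′ n → QuasiOpen (X j) (X (suc j)) (f j)
  fⱼ-quasiOpen j j<n = denseLocalProduct⇒quasiOpen (X j) (X (suc j)) (f j) (Z j) (dZ j j<n) (lp j j<n)
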